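{- Let $\mathbf V$ be a commutative unital quantale, let $\mathbf H_1=(\mathbf A_1,F_1)$, $\mathbf H_2=(\mathbf A_2,F_2)$ be $\mathbf V$-F-semilattices, $\mathbf L$ a $\mathbf V$-module, and $f\colon\mathbf H_1\to\mathbf H_2$ a lax morphism. Then the map $\mathbf J[f,\mathbf L]\colon T_{[\mathbf H_2,\mathbf L]}\to T_{[\mathbf H_1,\mathbf L]}$, $(\mathbf J[f,\mathbf L](\alpha))(y)=\alpha(f(y))$ ($\alpha\in T_{[\mathbf H_2,\mathbf L]}$, $y\in A_1$), is a well-defined homomorphism of $\mathbf V$-frames $\mathbf J[\mathbf H_2,\mathbf L]\to\mathbf J[\mathbf H_1,\mathbf L]$. Moreover, $\mathbf J[-,\mathbf L]$ is a contravariant functor from $\mathbf V$-F-$\mathbb S_\le$ to $\mathbf V$-$\mathbb J$.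
   Context: A commutative unital quantale $\mathbf V=(V,\bigvee,\otimes,e)$: complete lattice, commutative monoid, $\otimes$ distributing over arbitrary joins. A $\mathbf V$-module $(A,\bigvee,*)$: complete lattice with $*\colon V\times A\to A$ preserving joins in each argument, $u*(v*a)=(u\otimes v)*a$, $e*a=a$; module homomorphisms preserve arbitrary joins and the action. A $\mathbf V$-frame is $(T,r)$ with $r\colon T\times T\to V$; a frame homomorphism $g\colon(T,r)\to(S,s)$ is a map with $r(i,j)\le s(g(i),g(j))$; $\mathbf V$-$\mathbb J$ is the category of frames. A $\mathbf V$-F-semilattice is $(\mathbf A,F)$ with $F$ a module endomorphism; a lax morphism $f\colon(\mathbf A_1,F_1)\to(\mathbf A_2,F_2)$ is a module homomorphism with $F_2(f(a))\le f(F_1(a))$; $\mathbf V$-F-$\mathbb S_\le$ is this category. For $a,b\in L$, $a\rightarrow b=\bigvee\{v\in V\mid v*a\le b\}$. $T_{[\mathbf H,\mathbf L]}$ is the set of module homomorphisms $\mathbf A\to\mathbf L$ for $\mathbf H=(\mathbf A,F)$, and $\mathbf J[\mathbf H,\mathbf L]=(T_{[\mathbf H,\mathbf L]},r)$ with $r(\alpha,\beta)=\bigwedge_{x\in A}(\beta(x)\rightarrow\alpha(F(x)))$. -}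

module Defs where

open import Data.Product using (Σ; _,_; proj₁; proj₂)
open import Data.Bool using (Bool; true; false)
open import Relation.Binary.PropositionalEquality
  using (_≡_; refl; sym; trans; cong; subst)

-- Complete lattices: a partial order (antisymmetric up to ≡) with joins
-- of all families indexed by small types (this covers joins of arbitrary subsets).
record CompleteLattice : Set₁ where
  field
    Carrier : Set
    _≤_     : Carrier → Carrier → Set
    ≤-refl  : ∀ {x} → x ≤ x
    ≤-trans : ∀ {x y z} → x ≤ y → y ≤ z → x ≤ z
    ≤-antisym : ∀ {x y} → x ≤ y → y ≤ x → x ≡ y
    ⋁       : {I : Set} → (I → Carrier) → Carrier
    ⋁-ub    : ∀ {I : Set} (f : I → Carrier) (i : I) → f i ≤ ⋁ f
    ⋁-lub   : ∀ {I : Set} (f : I → Carrier) (x : Carrier) →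
              (∀ i → f i ≤ x) → ⋁ f ≤ x

  ⋀ : {I : Set} → (I → Carrier) → Carrier
  ⋀ {I} f = ⋁ {Σ Carrier (λ v → ∀ (i : I) → v ≤ f i)} proj₁

record Quantale : Set₁ where
  field
    lattice : CompleteLattice
  open CompleteLattice lattice public
  field
    _⊗_      : Carrier → Carrier → Carrier
    e        : Carrier
    ⊗-assoc  : ∀ u v w → (u ⊗ v) ⊗ w ≡ u ⊗ (v ⊗ w)
    ⊗-comm   : ∀ u v → u ⊗ v ≡ v ⊗ u
    ⊗-identityˡ : ∀ u → e ⊗ u ≡ u
    ⊗-distrib-⋁ : ∀ (u : Carrier) {I : Set} (f : I → Carrier) →
                  u ⊗ ⋁ f ≡ ⋁ (λ i → u ⊗ f i)

record Module (V : Quantale) : Set₁ where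
  private module V = Quantale V
  field
    lattice : CompleteLattice
  open CompleteLattice lattice public
  field
    _*_     : V.Carrier → Carrier → Carrier
    *-⋁ˡ    : ∀ {I : Set} (f : I → V.Carrier) (a : Carrier) →
              (V.⋁ f) * a ≡ ⋁ (λ i → f i * a)
    *-⋁ʳ    : ∀ (v : V.Carrier) {I : Set} (g : I → Carrier) →
              v * (⋁ g) ≡ ⋁ (λ i → v * g i)
    *-assoc : ∀ u v a → u * (v * a) ≡ (u V.⊗ v) * a
    *-identity : ∀ a → V.e * a ≡ a

  _⇒_ : Carrier → Carrier → V.Carrier
  a ⇒ b = V.⋁ {Σ V.Carrier (λ v → (v * a) ≤ b)} proj₁

record ModHom {V : Quantale} (A B : Module V) : Set₁ where
  private
    module A = Module A
    module B = Module B
  field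
    fun      : A.Carrier → B.Carrier
    fun-⋁    : ∀ {I : Set} (g : I → A.Carrier) → fun (A.⋁ g) ≡ B.⋁ (λ i → fun (g i))
    fun-*    : ∀ v a → fun (v A.* a) ≡ v B.* fun a
open ModHom public

record FSemilattice (V : Quantale) : Set₁ where
  field
    mod : Module V
    F   : ModHom mod mod
open FSemilattice public

record LaxMor {V : Quantale} (H₁ H₂ : FSemilattice V) : Set₁ where
  private
    module A₂ = Module (mod H₂)
  field
    hom : ModHom (mod H₁) (mod H₂)
    lax : ∀ a → fun (F H₂) (fun hom a) A₂.≤ fun hom (fun (F H₁) a)
open LaxMor public

record Frame (V : Quantale) : Set₂ where
  field
    T : Set₁
    r : T → T → Quantale.Carrier V
open Frame public

record FrameHom {V : Quantale} (P Q : Frame V) : Set₁ where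
  field
    map  : T P → T Q
    mono : ∀ i j → Quantale._≤_ V (r P i j) (r Q (map i) (map j))
open FrameHom public

J[_,_] : {V : Quantale} → FSemilattice V → Module V → Frame V
J[_,_] {V} H L = record
  { T = ModHom (mod H) L
  ; r = λ α β → Quantale.⋀ V
          (λ (x : Module.Carrier (mod H)) →
             Module._⇒_ L (fun β x) (fun α (fun (F H) x)))
  }

module _ {V : Quantale} where

  idModHom : (A : Module V) → ModHom A A
  idModHom A = record { fun = λ a → a ; fun-⋁ = λ g → refl ; fun-* = λ v a → refl }

  _∘M_ : {A B C : Module V} → ModHom B C → ModHom A B → ModHom A C
  _∘M_ {A} {B} {C} g f = record
    { fun   = λ a → fun g (fun f a)
    ; fun-⋁ = λ h → trans (cong (fun g) (fun-⋁ f h)) (fun-⋁ g (λ i → fun f (h i)))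
    ; fun-* = λ v a → trans (cong (fun g) (fun-* f v a)) (fun-* g v (fun f a))
    }

  homMono : {A B : Module V} (g : ModHom A B) {a b : Module.Carrier A} →
            Module._≤_ A a b → Module._≤_ B (fun g a) (fun g b)
  homMono {A} {B} g {a} {b} a≤b =
    subst (λ z → fun g a B.≤ z) (sym gb≡) (B.⋁-ub (λ i → fun g (pair i)) true)
    where
      module A = Module A
      module B = Module B
      pair : Bool → A.Carrier
      pair true  = a
      pair false = b
      b≡ : A.⋁ pair ≡ b
      b≡ = A.≤-antisym (A.⋁-lub pair b (λ { true → a≤b ; false → A.≤-refl }))
                       (A.⋁-ub pair false)
      gb≡ : fun g b ≡ B.⋁ (λ i → fun g (pair i))
      gb≡ = trans (cong (fun g) (sym b≡)) (fun-⋁ g pair)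

  idLax : (H : FSemilattice V) → LaxMor H H
  idLax H = record { hom = idModHom (mod H) ; lax = λ a → Module.≤-refl (mod H) }

  _∘L_ : {H₁ H₂ H₃ : FSemilattice V} → LaxMor H₂ H₃ → LaxMor H₁ H₂ → LaxMor H₁ H₃
  _∘L_ {H₁} {H₂} {H₃} g f = record
    { hom = hom g ∘M hom f
    ; lax = λ a → Module.≤-trans (mod H₃) (lax g (fun (hom f) a))
                    (homMono (hom g) (lax f a))
    }

-- For the frame inequality of α ↦ α ∘ f, bound the meet r(α, β) by its component at x = f y
-- and enlarge the target α(F₂(f y)) to α(f(F₁ y)): this uses laxness of f,
-- monotonicity of α, and monotonicity of ⇒ in its second argument.
-- Functoriality holds definitionally, since composition of lax morphisms is
-- composition of the underlying functions.
module Submission where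

open import Defs
open import Data.Product using (Σ; _×_; _,_; proj₁; proj₂)
open import Relation.Binary.PropositionalEquality using (_≡_; refl)

module _ (X : CompleteLattice) where
  open CompleteLattice X

  ⋀-lowerBound : ∀ {I : Set} (g : I → Carrier) i → ⋀ g ≤ g i
  ⋀-lowerBound g i = ⋁-lub proj₁ (g i) (λ lower → proj₂ lower i)

  ⋀-greatest : ∀ {I : Set} (g : I → Carrier) x → (∀ i → x ≤ g i) → x ≤ ⋀ g
  ⋀-greatest g x x≤g = ⋁-ub proj₁ (x , x≤g)

module _ {V : Quantale} (L : Module V) where
  private
    module V = Quantale V
  open Module L

  ⇒-monoʳ : ∀ a {b b′} → b ≤ b′ → (a ⇒ b) V.≤ (a ⇒ b′)
  ⇒-monoʳ a b≤b′ =
    V.⋁-lub proj₁ _ (λ (v , v*a≤b) → V.⋁-ub proj₁ (v , ≤-trans v*a≤b b≤b′))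

  J[_,L] : {H₁ H₂ : FSemilattice V} → LaxMor H₁ H₂ → FrameHom J[ H₂ , L ] J[ H₁ , L ]
  J[_,L] f = record
    { map  = λ α → α ∘M hom f
    ; mono = λ α β → ⋀-greatest V.lattice _ _ λ y →
        V.≤-trans (⋀-lowerBound V.lattice _ (fun (hom f) y))
                  (⇒-monoʳ _ (homMono α (lax f y)))
    }

mainTheorem10 : (V : Quantale) (L : Module V) →
    Σ ({H₁ H₂ : FSemilattice V} → LaxMor H₁ H₂ → FrameHom J[ H₂ , L ] J[ H₁ , L ])
      (λ J →
        (∀ {H₁ H₂ : FSemilattice V} (f : LaxMor H₁ H₂) (α : ModHom (mod H₂) L)
           (y : Module.Carrier (mod H₁)) →
           fun (map (J f) α) y ≡ fun α (fun (hom f) y))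
        × (∀ {H : FSemilattice V} (α : ModHom (mod H) L) (y : Module.Carrier (mod H)) →
             fun (map (J (idLax H)) α) y ≡ fun α y)
        × (∀ {H₁ H₂ H₃ : FSemilattice V} (f : LaxMor H₁ H₂) (g : LaxMor H₂ H₃)
             (α : ModHom (mod H₃) L) (y : Module.Carrier (mod H₁)) →
             fun (map (J (g ∘L f)) α) y ≡ fun (map (J f) (map (J g) α)) y))
mainTheorem10 V L =
  J[_,L] L , (λ f α y → refl) , (λ α y → refl) , (λ f g α y → refl)
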